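{- Let $k \ge 2$ be an integer. If $G$ is a graph on $2k$ vertices with $\beta^k(G) \ge 1$, then $G$ is complete.
   Context: All graphs are finite and simple. For $S\subseteq V(G)$, $\Lambda^k_G(S)$ is the set of vertices with at least $k$ neighbors in $S$, and $\beta^k(G)=\min\{|\Lambda^k_G(S)|/|S| : S\subseteq V(G),\ |S|\ge k,\ \Lambda^k_G(S)\ne V(G)\}$, with $\beta^k(G)=0$ if $|V(G)|<k$. -}

module Defs where

open import Data.Nat using (ℕ; _≤_; _≤ᵇ_)
open import Data.Bool using (Bool; true; false; if_then_else_)
open import Data.Fin using (Fin)
open import Data.Fin.Subset using (Subset; inside; outside; ∣_∣; _∩_; ⊤)
open import Data.Vec using (tabulate)
open import Relation.Binary.PropositionalEquality using (_≡_; _≢_)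

record Graph (n : ℕ) : Set where
  field
    adj   : Fin n → Fin n → Bool
    sym   : ∀ u v → adj u v ≡ adj v u
    irrefl : ∀ v → adj v v ≡ false
open Graph public

N : ∀ {n} → Graph n → Fin n → Subset n
N G v = tabulate (λ u → if adj G v u then inside else outside)

Λ : ∀ {n} → ℕ → Graph n → Subset n → Subset n
Λ k G S = tabulate (λ v → if k ≤ᵇ ∣ S ∩ N G v ∣ then inside else outside)

-- β^k(G) ≥ 1: the minimum of |Λ^k_G(S)|/|S| over all S with |S| ≥ k and
-- Λ^k_G(S) ≠ V(G) is at least 1, i.e. every such S has |S| ≤ |Λ^k_G(S)|.
-- (For |V(G)| < k the paper sets β^k(G) = 0; this case never arises below,
--  since n = 2k ≥ k.)
β≥1 : ∀ {n} → ℕ → Graph n → Set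
β≥1 k G = ∀ (S : Subset _) → k ≤ ∣ S ∣ → Λ k G S ≢ ⊤ → ∣ S ∣ ≤ ∣ Λ k G S ∣

Complete : ∀ {n} → Graph n → Set
Complete G = ∀ u v → u ≢ v → adj G u v ≡ true

{-# OPTIONS --safe #-}

-- If u ≠ v are non-adjacent, choose S ∋ u with |S| = k and v ∉ S. A vertex with a
-- non-neighbour in S has fewer than k neighbours there; every w ∈ S misses itself and
-- v misses u, so Λᵏ(S) is disjoint from S and avoids v. Then Λᵏ(S) ≠ V, β ≥ 1 gives
-- |Λᵏ(S)| ≥ k, and S, Λᵏ(S), {v} are disjoint inside V: 2k + 1 ≤ n, so n > 2k.

module Submission where

open import Defs
open import Data.Nat using (ℕ; _≤_; _*_; suc; _+_; _<_; _∸_; _≤ᵇ_; z≤n; s≤s; z<s; s≤s⁻¹)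
open import Data.Nat.Properties
open import Data.Bool using (Bool; true; false; T; if_then_else_)
open import Data.Unit using (tt)
open import Data.Fin using (Fin; zero)
open import Data.Fin.Subset
open import Data.Fin.Subset.Properties
open import Data.Vec using ([]; _∷_; tabulate; here)
open import Data.Vec.Properties using ([]=⇒lookup; lookup∘tabulate)
open import Data.Product using (_×_; _,_; proj₂; ∃-syntax)
open import Data.Sum using (inj₁; inj₂; [_,_])
open import Function using (_∘_)
open import Relation.Binary.PropositionalEquality using (_≡_; _≢_; refl; trans; cong; subst)
  renaming (sym to ≡-sym)
open import Relation.Nullary using (contradiction)

private
  variable
    n m : ℕ
    a p q : Subset n
    x : Fin n

p∩q≡∅⇒∣p∪q∣≡∣p∣+∣q∣ : ∀ (p q : Subset n) → Empty (p ∩ q) → ∣ p ∪ q ∣ ≡ ∣ p ∣ + ∣ q ∣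
p∩q≡∅⇒∣p∪q∣≡∣p∣+∣q∣ []            []            _     = refl
p∩q≡∅⇒∣p∪q∣≡∣p∣+∣q∣ (inside  ∷ p) (inside  ∷ q) p∩q≡∅ = contradiction (zero , here) p∩q≡∅
p∩q≡∅⇒∣p∪q∣≡∣p∣+∣q∣ (inside  ∷ p) (outside ∷ q) p∩q≡∅ =
  cong suc (p∩q≡∅⇒∣p∪q∣≡∣p∣+∣q∣ p q (drop-∷-Empty p∩q≡∅))
p∩q≡∅⇒∣p∪q∣≡∣p∣+∣q∣ (outside ∷ p) (inside  ∷ q) p∩q≡∅ =
  trans (cong suc (p∩q≡∅⇒∣p∪q∣≡∣p∣+∣q∣ p q (drop-∷-Empty p∩q≡∅))) (≡-sym (+-suc ∣ p ∣ ∣ q ∣))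
p∩q≡∅⇒∣p∪q∣≡∣p∣+∣q∣ (outside ∷ p) (outside ∷ q) p∩q≡∅ =
  p∩q≡∅⇒∣p∪q∣≡∣p∣+∣q∣ p q (drop-∷-Empty p∩q≡∅)

p∩q≡∅∧x∉p∪q⇒∣p∣+∣q∣<n : ∀ (p q : Subset n) → Empty (p ∩ q) → x ∉ p ∪ q → ∣ p ∣ + ∣ q ∣ < n
p∩q≡∅∧x∉p∪q⇒∣p∣+∣q∣<n {n} {x} p q p∩q≡∅ x∉p∪q = begin-strict
  ∣ p ∣ + ∣ q ∣ ≡⟨ ≡-sym (p∩q≡∅⇒∣p∪q∣≡∣p∣+∣q∣ p q p∩q≡∅) ⟩
  ∣ p ∪ q ∣     <⟨ p⊂q⇒∣p∣<∣q∣ (⊆⊤ , x , ∈⊤ , x∉p∪q) ⟩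
  ∣ ⊤ {n} ∣     ≡⟨ ∣⊤∣≡n n ⟩
  n             ∎
  where open ≤-Reasoning

x∈p∧x∉q⇒∣p∩q∣<∣p∣ : x ∈ p → x ∉ q → ∣ p ∩ q ∣ < ∣ p ∣
x∈p∧x∉q⇒∣p∩q∣<∣p∣ {x = x} {p} {q} x∈p x∉q =
  p⊂q⇒∣p∣<∣q∣ (p∩q⊆p p q , x , x∈p , x∉q ∘ proj₂ ∘ x∈p∩q⁻ p q)

subset-between : a ⊆ q → ∣ a ∣ ≤ m → m ≤ ∣ q ∣ → ∃[ p ] a ⊆ p × p ⊆ q × ∣ p ∣ ≡ m
subset-between {a = []} {[]} _ _ z≤n = [] , ⊆-refl , ⊆-refl , refl
subset-between {a = inside ∷ a} {outside ∷ q} a⊆q = contradiction (a⊆q here) λ ()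
subset-between {a = inside ∷ a} {inside ∷ q} a⊆q (s≤s ∣a∣≤m) (s≤s m≤∣q∣)
  with p , a⊆p , p⊆q , refl ← subset-between (drop-∷-⊆ a⊆q) ∣a∣≤m m≤∣q∣
  = inside ∷ p , in⊆in a⊆p , in⊆in p⊆q , refl
subset-between {a = outside ∷ a} {outside ∷ q} a⊆q ∣a∣≤m m≤∣q∣
  with p , a⊆p , p⊆q , ∣p∣≡m ← subset-between (drop-∷-⊆ a⊆q) ∣a∣≤m m≤∣q∣
  = outside ∷ p , out⊆ a⊆p , out⊆ p⊆q , ∣p∣≡m
subset-between {a = outside ∷ a} {inside ∷ q} a⊆q ∣a∣≤m m≤1+∣q∣ with m≤n⇒m<n∨m≡n m≤1+∣q∣
... | inj₂ refl = inside ∷ q , a⊆q , ⊆-refl , refl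
... | inj₁ (s≤s m≤∣q∣)
  with p , a⊆p , p⊆q , ∣p∣≡m ← subset-between (drop-∷-⊆ a⊆q) ∣a∣≤m m≤∣q∣
  = outside ∷ p , out⊆ a⊆p , out⊆ p⊆q , ∣p∣≡m

separating-subset : ∀ {n m} {x y : Fin n} → x ≢ y → 0 < m → m < n →
                    ∃[ p ] x ∈ p × y ∉ p × ∣ p ∣ ≡ m
separating-subset {suc n} {m} {x} {y} x≢y 0<m m<1+n
  = let p , ⁅x⁆⊆p , p⊆∁⁅y⁆ , ∣p∣≡m = subset-between ⁅x⁆⊆∁⁅y⁆ ∣⁅x⁆∣≤m m≤∣∁⁅y⁆∣ in
    p , ⁅x⁆⊆p (x∈⁅x⁆ x) , (λ y∈p → x∈∁p⇒x∉p (p⊆∁⁅y⁆ y∈p) (x∈⁅x⁆ y)) , ∣p∣≡m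
  where
  ⁅x⁆⊆∁⁅y⁆ : ⁅ x ⁆ ⊆ ∁ ⁅ y ⁆
  ⁅x⁆⊆∁⁅y⁆ z∈⁅x⁆ = x∉p⇒x∈∁p (x≢y⇒x∉⁅y⁆ λ z≡y → x≢y (trans (≡-sym (x∈⁅y⁆⇒x≡y x z∈⁅x⁆)) z≡y))
  ∣⁅x⁆∣≤m : ∣ ⁅ x ⁆ ∣ ≤ m
  ∣⁅x⁆∣≤m = subst (_≤ _) (≡-sym (∣⁅x⁆∣≡1 x)) 0<m
  m≤∣∁⁅y⁆∣ : m ≤ ∣ ∁ ⁅ y ⁆ ∣
  m≤∣∁⁅y⁆∣ = subst (_ ≤_) (≡-sym (trans (∣∁p∣≡n∸∣p∣ ⁅ y ⁆) (cong (suc n ∸_) (∣⁅x⁆∣≡1 y)))) (s≤s⁻¹ m<1+n)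

∈tabulate⇒T : ∀ (f : Fin n → Bool) → x ∈ tabulate (λ y → if f y then inside else outside) → T (f x)
∈tabulate⇒T {x = x} f x∈ with f x | trans (≡-sym (lookup∘tabulate _ x)) ([]=⇒lookup x∈)
... | true  | _  = tt
... | false | ()

nonadjacent⇒∉N : ∀ (G : Graph n) {w x} → adj G w x ≡ false → x ∉ N G w
nonadjacent⇒∉N G {w} adj≡false x∈N = subst T adj≡false (∈tabulate⇒T (adj G w) x∈N)

∈Λ⇒k≤∣S∩N∣ : ∀ k (G : Graph n) {S w} → w ∈ Λ k G S → k ≤ ∣ S ∩ N G w ∣
∈Λ⇒k≤∣S∩N∣ k G {S} w∈Λ = ≤ᵇ⇒≤ k _ (∈tabulate⇒T (λ v → k ≤ᵇ ∣ S ∩ N G v ∣) w∈Λ)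

nonadjacent-member⇒∉Λ : ∀ k (G : Graph n) {S w x} →
                         ∣ S ∣ ≤ k → x ∈ S → adj G w x ≡ false → w ∉ Λ k G S
nonadjacent-member⇒∉Λ k G {S} ∣S∣≤k x∈S adj≡false w∈Λ =
  <⇒≱ (≤-trans (x∈p∧x∉q⇒∣p∩q∣<∣p∣ x∈S (nonadjacent⇒∉N G adj≡false)) ∣S∣≤k)
      (∈Λ⇒k≤∣S∩N∣ k G {S} w∈Λ)

nonadjacent-separated⇒2∣S∣<n : ∀ (G : Graph n) {S u v} → β≥1 ∣ S ∣ G →
                               u ∈ S → v ∉ S → adj G u v ≡ false → 2 * ∣ S ∣ < n
nonadjacent-separated⇒2∣S∣<n {n} G {S} {u} {v} β u∈S v∉S adj≡false = begin-strict
  2 * ∣ S ∣     ≡⟨ cong (∣ S ∣ +_) (+-identityʳ ∣ S ∣) ⟩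
  ∣ S ∣ + ∣ S ∣ ≤⟨ +-monoʳ-≤ ∣ S ∣ ∣S∣≤∣L∣ ⟩
  ∣ S ∣ + ∣ L ∣ <⟨ p∩q≡∅∧x∉p∪q⇒∣p∣+∣q∣<n S L S∩L≡∅ ([ v∉S , v∉L ] ∘ x∈p∪q⁻ S L) ⟩
  n             ∎
  where
  open ≤-Reasoning
  L : Subset n
  L = Λ ∣ S ∣ G S
  S∩L≡∅ : Empty (S ∩ L)
  S∩L≡∅ (w , w∈S∩L) = let w∈S , w∈L = x∈p∩q⁻ S L w∈S∩L in
    nonadjacent-member⇒∉Λ _ G ≤-refl w∈S (irrefl G w) w∈L
  v∉L : v ∉ L
  v∉L = nonadjacent-member⇒∉Λ _ G ≤-refl u∈S (trans (sym G v u) adj≡false)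
  L≢⊤ : L ≢ ⊤
  L≢⊤ L≡⊤ = S∩L≡∅ (u , x∈p∩q⁺ (u∈S , subst (u ∈_) (≡-sym L≡⊤) ∈⊤))
  ∣S∣≤∣L∣ : ∣ S ∣ ≤ ∣ L ∣
  ∣S∣≤∣L∣ = β S ≤-refl L≢⊤

β≥1⇒complete : ∀ k → k < n → n ≤ 2 * k → (G : Graph n) → β≥1 k G → Complete G
β≥1⇒complete {n} k k<n n≤2k G β u v u≢v with adj G u v in adj≡
... | true  = refl
... | false = contradiction n≤2k (<⇒≱ 2k<n)
  where
  0<k : 0 < k
  0<k = n≢0⇒n>0 λ { refl → <⇒≱ k<n n≤2k }
  2k<n : 2 * k < n
  2k<n with S , u∈S , v∉S , refl ← separating-subset u≢v 0<k k<n =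
    nonadjacent-separated⇒2∣S∣<n G β u∈S v∉S adj≡

corollary2p6 : (k : ℕ) → 2 ≤ k → (G : Graph (2 * k)) → β≥1 k G → Complete G
corollary2p6 k 2≤k = β≥1⇒complete k (m<m+n k (<-≤-trans 0<k (m≤m+n k 0))) ≤-refl
  where
  0<k : 0 < k
  0<k = <-trans z<s 2≤k
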